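{- Let $\overline{C_n}$ be the complement of the cycle $C_n$ of order $n\geq 4$. Then $\chi_d^t(\overline{C_n})=4$ if $n\in\{4,5\}$, and $\chi_d^t(\overline{C_n})=\lceil n/2\rceil$ if $n\geq 6$.
   Context: The complement $\overline{G}$ of a graph $G$ has vertex set $V(G)$, with $vw$ an edge iff $vw\notin E(G)$. A total dominator coloring of a graph $G$ is a proper vertex coloring of $G$ in which each vertex of $G$ is adjacent to every vertex of some color class; $\chi_d^t(G)$ is the minimum number of color classes in a total dominator coloring of $G$. -}

module Defs where

open import Data.Nat using (ℕ; zero; suc; _+_; _≤_; _%_; _/_; NonZero)
open import Data.Fin using (Fin; toℕ)
open import Data.Product using (Σ; ∃; _×_; _,_)
import Data.Product
open import Data.Sum using (_⊎_; swap)
open import Relation.Nullary using (¬_)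
open import Relation.Binary.PropositionalEquality using (_≡_; refl) renaming (sym to ≡-sym)
open import Level using (0ℓ)
open import Relation.Binary using (Rel)

record Graph (n : ℕ) : Set₁ where
  field
    Adj   : Rel (Fin n) 0ℓ
    irrefl : ∀ v → ¬ Adj v v
    sym    : ∀ {v w} → Adj v w → Adj w v
open Graph public

CycAdj : (n : ℕ) .{{_ : NonZero n}} → Rel (Fin n) 0ℓ
CycAdj n u w = (toℕ w ≡ (suc (toℕ u)) % n) ⊎ (toℕ u ≡ (suc (toℕ w)) % n)

CompCycAdj : (n : ℕ) .{{_ : NonZero n}} → Rel (Fin n) 0ℓ
CompCycAdj n u w = ¬ (u ≡ w) × ¬ CycAdj n u w

complementCycle : (n : ℕ) .{{_ : NonZero n}} → Graph n
complementCycle n = record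
  { Adj = CompCycAdj n
  ; irrefl = λ v p → Data.Product.proj₁ p refl
  ; sym = λ { (ne , nc) → (λ e → ne (≡-sym e)) , (λ c → nc (swap c)) }
  }

-- A total dominator coloring of G using exactly k colour classes:
-- a surjective colouring c : Fin n → Fin k (so all k classes are nonempty),
-- proper, and every vertex is adjacent to every vertex of some colour class.
record TotalDominatorColoring {n : ℕ} (G : Graph n) (k : ℕ) : Set where
  field
    col        : Fin n → Fin k
    surjective : ∀ (i : Fin k) → ∃ λ v → col v ≡ i
    proper     : ∀ {v w} → Adj G v w → ¬ (col v ≡ col w)
    dominating : ∀ (v : Fin n) → ∃ λ (i : Fin k) → ∀ (u : Fin n) → col u ≡ i → Adj G v u

TotalDominatorChromaticNumber : {n : ℕ} → Graph n → ℕ → Set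
TotalDominatorChromaticNumber G k =
  TotalDominatorColoring G k × (∀ m → TotalDominatorColoring G m → k ≤ m)

ceilHalf : ℕ → ℕ
ceilHalf n = (n + 1) / 2

-- In the complement of C_n (n ≥ 4) a color class is independent, i.e. a clique of the
-- triangle-free cycle C_n, so it has at most two vertices and at least ⌈n/2⌉ colors are needed.
-- For n ≥ 6 the classes {2j, 2j+1} are independent, and every vertex is adjacent to both vertices
-- of one of {0,1}, {2,3}, {4,5}. For n = 4 the complement is a perfect matching, so every vertex
-- is alone in its class. For n = 5 the complement is again a 5-cycle; fewer than four colors would
-- make two disjoint edges of C₅ monochromatic, and then the vertex whose two neighbors lie one on
-- each of them has no class inside its neighborhood.

module Submission where

open import Defs hiding (sym)
open import Data.Empty using (⊥; ⊥-elim)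
open import Data.Fin using (Fin; zero; suc; toℕ; fromℕ<; combine; #_)
open import Data.Fin.Properties
  using (toℕ-injective; toℕ-fromℕ<; toℕ<n; injective⇒≤; combine-injective; any?; all?; _≟_; _<?_; <-cmp; <⇒≢)
import Data.Fin as Fin
open import Data.Nat using (ℕ; zero; suc; _+_; _*_; _≤_; _<_; z≤n; s≤s; NonZero; _%_; _/_; ⌊_/2⌋; ⌈_/2⌉)
import Data.Nat as ℕ
open import Data.Nat.Properties
  using ( ≤-trans; ≤-reflexive; ≤-<-trans; <-trans; <-irrefl; <-asym; <⇒≱; ≰⇒>; n≮0
        ; n≤1+n; m≤m+n; m≤n⇒m<n∨m≡n; suc-injective; +-comm; ⌈n/2⌉-mono)
open import Data.Nat.DivMod using (_mod_; m<n⇒m%n≡m; n%n≡0; m/n≡1+[m∸n]/n)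
open import Data.Product using (_×_; _,_; ∃)
open import Data.Sum using (_⊎_; inj₁; inj₂; [_,_])
import Data.Sum as Sum
open import Data.Vec using (Vec; []; _∷_)
open import Data.Vec.Relation.Unary.All using ([]; _∷_)
open import Data.Vec.Relation.Unary.AllPairs using ([]; _∷_)
open import Data.Vec.Relation.Unary.Unique.Propositional using (Unique)
open import Data.Vec.Relation.Unary.Unique.Propositional.Properties using (lookup-injective)
open import Function using (id; case_of_)
open import Relation.Binary using (Decidable; tri<; tri≈; tri>)
open import Relation.Binary.PropositionalEquality
  using (_≡_; _≢_; refl; sym; trans; cong; subst; module ≡-Reasoning)
open import Relation.Nullary using (¬_; Dec; yes; no)
open import Relation.Nullary.Decidable
  using (True; False; toWitness; toWitnessFalse; from-yes; decidable-stable; ¬?; _×-dec_; _⊎-dec_; _→-dec_)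

module _ {n k : ℕ} {G : Graph n} (T : TotalDominatorColoring G k) where
  open TotalDominatorColoring T

  dominatingNeighbour : ∀ v → ∃ λ x → Adj G v x × (∀ u → col u ≡ col x → Adj G v u)
  dominatingNeighbour v with dominating v
  ... | i , dom with surjective i
  ...   | x , refl = x , dom x refl , dom

  noDominatingClass : ∀ v → ¬ (∀ x → Adj G v x → ∃ λ y → ¬ Adj G v y × col y ≡ col x)
  noDominatingClass v escapes with dominatingNeighbour v
  ... | x , v~x , class⊆N with escapes x v~x
  ...   | y , v≁y , same = v≁y (class⊆N y same)

IsTotalDominatorColoring : ∀ {n k} → Graph n → (Fin n → Fin k) → Set
IsTotalDominatorColoring G col =
  (∀ i → ∃ λ v → col v ≡ i) ×
  (∀ v w → Adj G v w → col v ≢ col w) ×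
  (∀ v → ∃ λ i → ∀ u → col u ≡ i → Adj G v u)

isTotalDominatorColoring? : ∀ {n k} {G : Graph n} → Decidable (Adj G) →
                            (col : Fin n → Fin k) → Dec (IsTotalDominatorColoring G col)
isTotalDominatorColoring? adj? col =
  all? (λ i → any? λ v → col v ≟ i) ×-dec
  all? (λ v → all? λ w → adj? v w →-dec ¬? (col v ≟ col w)) ×-dec
  all? (λ v → any? λ i → all? λ u → col u ≟ i →-dec adj? v u)

toTotalDominatorColoring : ∀ {n k} {G : Graph n} {col : Fin n → Fin k} →
                           IsTotalDominatorColoring G col → TotalDominatorColoring G k
toTotalDominatorColoring {col = col} (surjective , proper , dominating) = record
  { col = col ; surjective = surjective ; proper = λ {v} {w} → proper v w ; dominating = dominating }

record IsAutomorphism {n : ℕ} (G : Graph n) (σ : Fin n → Fin n) : Set where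
  field
    surjective : ∀ v → ∃ λ u → σ u ≡ v
    preserves  : ∀ {v w} → Adj G v w → Adj G (σ v) (σ w)
    reflects   : ∀ {v w} → Adj G (σ v) (σ w) → Adj G v w

precomposeAutomorphism : ∀ {n k} {G : Graph n} {σ : Fin n → Fin n} → IsAutomorphism G σ →
                         TotalDominatorColoring G k → TotalDominatorColoring G k
precomposeAutomorphism {G = G} {σ} aut T = record
  { col        = λ v → col (σ v)
  ; surjective = surjective′
  ; proper     = λ v~w → proper (preserves v~w)
  ; dominating = dominating′
  }
  where
  open TotalDominatorColoring T
  open IsAutomorphism aut renaming (surjective to σ-surjective)

  surjective′ : ∀ i → ∃ λ v → col (σ v) ≡ i
  surjective′ i with surjective i
  ... | v , refl with σ-surjective v
  ...   | u , refl = u , refl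

  dominating′ : ∀ v → ∃ λ i → ∀ u → col (σ u) ≡ i → Adj G v u
  dominating′ v with dominating (σ v)
  ... | i , dom = i , λ u same → reflects (dom (σ u) same)

AtMostTwoToOne : ∀ {n m} → (Fin n → Fin m) → Set
AtMostTwoToOne f = ∀ {u v w} → u Fin.< v → v Fin.< w → f u ≡ f v → f v ≡ f w → ⊥

atMostTwoToOne⇒≤*2 : ∀ {n m} {f : Fin n → Fin m} → AtMostTwoToOne f → n ≤ m * 2
atMostTwoToOne⇒≤*2 {n} {m} {f} twoToOne = injective⇒≤ tagged-injective
  where
  earlier? : ∀ v → Dec (∃ λ u → u Fin.< v × f u ≡ f v)
  earlier? v = any? λ u → (u <? v) ×-dec (f u ≟ f v)

  flag : ∀ {A : Set} → Dec A → Fin 2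
  flag (yes _) = # 1
  flag (no _)  = # 0

  -- Within a color class only the later vertex is flagged, so (color, flag) is injective.
  tagged : Fin n → Fin (m * 2)
  tagged v = combine (f v) (flag (earlier? v))

  flags-differ : ∀ {u w} → u Fin.< w → f u ≡ f w → flag (earlier? u) ≢ flag (earlier? w)
  flags-differ {u} {w} u<w same with earlier? u | earlier? w
  ... | yes (t , t<u , same′) | _      = λ _ → twoToOne t<u u<w same′ same
  ... | no _                  | yes _  = λ ()
  ... | no _                  | no ¬uw = λ _ → ¬uw (u , u<w , same)

  tagged-injective : ∀ {u w} → tagged u ≡ tagged w → u ≡ w
  tagged-injective {u} {w} eq with combine-injective (f u) _ (f w) _ eq | <-cmp u w
  ... | same , flags | tri< u<w _ _ = ⊥-elim (flags-differ u<w same flags)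
  ... | _            | tri≈ _ u≡w _ = u≡w
  ... | same , flags | tri> _ _ w<u = ⊥-elim (flags-differ w<u (sym same) (sym flags))

distinct⇒≤ : ∀ {k m} {xs : Vec (Fin m) k} → Unique xs → k ≤ m
distinct⇒≤ unique = injective⇒≤ (lookup-injective unique _ _)

n/2≡⌊n/2⌋ : ∀ n → n / 2 ≡ ⌊ n /2⌋
n/2≡⌊n/2⌋ 0 = refl
n/2≡⌊n/2⌋ 1 = refl
n/2≡⌊n/2⌋ (suc (suc n)) = trans (m/n≡1+[m∸n]/n {suc (suc n)} {2} (s≤s (s≤s z≤n))) (cong suc (n/2≡⌊n/2⌋ n))

ceilHalf≡⌈n/2⌉ : ∀ n → ceilHalf n ≡ ⌈ n /2⌉
ceilHalf≡⌈n/2⌉ n = trans (cong (_/ 2) (+-comm n 1)) (n/2≡⌊n/2⌋ (suc n))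

⌊n*2/2⌋≡n : ∀ n → ⌊ n * 2 /2⌋ ≡ n
⌊n*2/2⌋≡n zero    = refl
⌊n*2/2⌋≡n (suc n) = cong suc (⌊n*2/2⌋≡n n)

⌈n*2/2⌉≡n : ∀ n → ⌈ n * 2 /2⌉ ≡ n
⌈n*2/2⌉≡n zero    = refl
⌈n*2/2⌉≡n (suc n) = cong suc (⌈n*2/2⌉≡n n)

n≤m*2⇒⌈n/2⌉≤m : ∀ {n m} → n ≤ m * 2 → ⌈ n /2⌉ ≤ m
n≤m*2⇒⌈n/2⌉≤m {m = m} n≤m*2 = ≤-trans (⌈n/2⌉-mono n≤m*2) (≤-reflexive (⌈n*2/2⌉≡n m))

⌊n/2⌋-fiber : ∀ x j → ⌊ x /2⌋ ≡ j → x ≡ j * 2 ⊎ x ≡ suc (j * 2)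
⌊n/2⌋-fiber 0 _ refl = inj₁ refl
⌊n/2⌋-fiber 1 _ refl = inj₂ refl
⌊n/2⌋-fiber (suc (suc x)) (suc j) eq =
  Sum.map (cong (2 +_)) (cong (2 +_)) (⌊n/2⌋-fiber x j (suc-injective eq))

⌊n/2⌋-sameFiber : ∀ a b → ⌊ a /2⌋ ≡ ⌊ b /2⌋ → a ≡ b ⊎ b ≡ suc a ⊎ a ≡ suc b
⌊n/2⌋-sameFiber a b eq with ⌊n/2⌋-fiber a _ refl | ⌊n/2⌋-fiber b _ (sym eq)
... | inj₁ a≡ | inj₁ b≡ = inj₁ (trans a≡ (sym b≡))
... | inj₁ a≡ | inj₂ b≡ = inj₂ (inj₁ (trans b≡ (cong suc (sym a≡))))
... | inj₂ a≡ | inj₁ b≡ = inj₂ (inj₂ (trans a≡ (cong suc (sym b≡))))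
... | inj₂ a≡ | inj₂ b≡ = inj₁ (trans a≡ (sym b≡))

module _ {n : ℕ} .{{_ : NonZero n}} where

  cycAdj? : Decidable (CycAdj n)
  cycAdj? u w = (toℕ w ℕ.≟ suc (toℕ u) % n) ⊎-dec (toℕ u ℕ.≟ suc (toℕ w) % n)

  compCycAdj? : Decidable (CompCycAdj n)
  compCycAdj? u w = ¬? (u ≟ w) ×-dec ¬? (cycAdj? u w)

  successor⇒cycAdj : ∀ {u w : Fin n} → toℕ w ≡ suc (toℕ u) → CycAdj n u w
  successor⇒cycAdj {u} {w} w≡1+u = inj₁ (trans w≡1+u (sym (m<n⇒m%n≡m (subst (_< n) w≡1+u (toℕ<n w)))))

  cycAdj-ordered : ∀ {u w : Fin n} → u Fin.< w → CycAdj n u w →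
                   toℕ w ≡ suc (toℕ u) ⊎ (toℕ u ≡ 0 × suc (toℕ w) ≡ n)
  cycAdj-ordered {u} {w} u<w (inj₁ w≡) = inj₁ (trans w≡ (m<n⇒m%n≡m (≤-<-trans u<w (toℕ<n w))))
  cycAdj-ordered {u} {w} u<w (inj₂ u≡) with m≤n⇒m<n∨m≡n (toℕ<n w)
  ... | inj₁ 1+w<n = ⊥-elim (<-asym u<w (≤-reflexive (sym (trans u≡ (m<n⇒m%n≡m 1+w<n)))))
  ... | inj₂ 1+w≡n = inj₂ (trans u≡ (trans (cong (_% n) 1+w≡n) (n%n≡0 n)) , 1+w≡n)

  cycle-triangleFree : 4 ≤ n → ∀ {u v w : Fin n} → u Fin.< v → v Fin.< w →
                       CycAdj n u v → CycAdj n v w → CycAdj n u w → ⊥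
  cycle-triangleFree 4≤n {u} {v} {w} u<v v<w u~v v~w u~w
    with cycAdj-ordered u<v u~v | cycAdj-ordered v<w v~w | cycAdj-ordered (<-trans u<v v<w) u~w
  ... | inj₂ (_ , 1+v≡n) | _ | _ = <-irrefl 1+v≡n (≤-<-trans v<w (toℕ<n w))
  ... | inj₁ _ | inj₂ (v≡0 , _) | _ = n≮0 (subst (toℕ u <_) v≡0 u<v)
  ... | inj₁ v≡1+u | inj₁ w≡1+v | inj₁ w≡1+u =
    <-irrefl (sym (suc-injective (trans (sym w≡1+v) w≡1+u))) u<v
  ... | inj₁ v≡1+u | inj₁ w≡1+v | inj₂ (u≡0 , 1+w≡n) = <-irrefl refl (subst (4 ≤_) n≡3 4≤n)
    where
    open ≡-Reasoning
    n≡3 : n ≡ 3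
    n≡3 = begin
      n           ≡⟨ sym 1+w≡n ⟩
      suc (toℕ w) ≡⟨ cong suc w≡1+v ⟩
      2 + toℕ v   ≡⟨ cong (2 +_) v≡1+u ⟩
      3 + toℕ u   ≡⟨ cong (3 +_) u≡0 ⟩
      3           ∎

  -- a and x differ by at least 2 and are not the pair {0, n-1}.
  data Apart (a x : ℕ) : Set where
    below : 2 + a ≤ x → suc x < n ⊎ 0 < a → Apart a x
    above : 2 + x ≤ a → suc a < n ⊎ 0 < x → Apart a x

  private
    ordered-apart⇒compCycAdj : ∀ {u w : Fin n} → 2 + toℕ u ≤ toℕ w → suc (toℕ w) < n ⊎ 0 < toℕ u →
                               CompCycAdj n u w
    ordered-apart⇒compCycAdj {u} {w} gap notEnds = u≢w , ¬u~w
      where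
      u<w : u Fin.< w
      u<w = ≤-trans (n≤1+n _) gap

      u≢w : u ≢ w
      u≢w u≡w = <-irrefl (cong toℕ u≡w) u<w

      ¬u~w : ¬ CycAdj n u w
      ¬u~w u~w with cycAdj-ordered u<w u~w
      ... | inj₁ w≡1+u         = <-irrefl refl (subst (2 + toℕ u ≤_) w≡1+u gap)
      ... | inj₂ (u≡0 , 1+w≡n) = [ <-irrefl 1+w≡n , <-irrefl (sym u≡0) ] notEnds

  apart⇒compCycAdj : ∀ {u w : Fin n} → Apart (toℕ u) (toℕ w) → CompCycAdj n u w
  apart⇒compCycAdj (below gap notEnds) = ordered-apart⇒compCycAdj gap notEnds
  apart⇒compCycAdj (above gap notEnds) = Graph.sym (complementCycle n) (ordered-apart⇒compCycAdj gap notEnds)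

-- Lower bound for n ≥ 4

module _ {n k : ℕ} .{{_ : NonZero n}} (T : TotalDominatorColoring (complementCycle n) k) where
  open TotalDominatorColoring T

  sameColor⇒cycAdj : ∀ {u w} → u ≢ w → col u ≡ col w → CycAdj n u w
  sameColor⇒cycAdj {u} {w} u≢w same = decidable-stable (cycAdj? u w) λ ¬u~w → proper (u≢w , ¬u~w) same

  color-atMostTwoToOne : 4 ≤ n → AtMostTwoToOne col
  color-atMostTwoToOne 4≤n u<v v<w cu≡cv cv≡cw =
    cycle-triangleFree 4≤n u<v v<w (edge u<v cu≡cv) (edge v<w cv≡cw) (edge (<-trans u<v v<w) (trans cu≡cv cv≡cw))
    where
    edge : ∀ {x y} → x Fin.< y → col x ≡ col y → CycAdj n x y
    edge x<y = sameColor⇒cycAdj (<⇒≢ x<y)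

  ⌈n/2⌉≤colors : 4 ≤ n → ⌈ n /2⌉ ≤ k
  ⌈n/2⌉≤colors 4≤n = n≤m*2⇒⌈n/2⌉≤m (atMostTwoToOne⇒≤*2 (color-atMostTwoToOne 4≤n))

-- Upper bound for n ≥ 6

module HalfColoring {n : ℕ} .{{_ : NonZero n}} (6≤n : 6 ≤ n) where

  half : Fin n → Fin ⌈ n /2⌉
  half v = fromℕ< {⌊ toℕ v /2⌋} (⌈n/2⌉-mono (toℕ<n v))

  toℕ-half : ∀ v → toℕ (half v) ≡ ⌊ toℕ v /2⌋
  toℕ-half v = toℕ-fromℕ< (⌈n/2⌉-mono (toℕ<n v))

  half-surjective : ∀ i → ∃ λ v → half v ≡ i
  half-surjective i = v , toℕ-injective (begin
      toℕ (half v)         ≡⟨ toℕ-half v ⟩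
      ⌊ toℕ v /2⌋          ≡⟨ cong ⌊_/2⌋ (toℕ-fromℕ< i*2<n) ⟩
      ⌊ toℕ i * 2 /2⌋      ≡⟨ ⌊n*2/2⌋≡n (toℕ i) ⟩
      toℕ i                ∎)
    where
    open ≡-Reasoning
    i*2<n : toℕ i * 2 < n
    i*2<n = ≰⇒> λ n≤i*2 → <⇒≱ (toℕ<n i) (n≤m*2⇒⌈n/2⌉≤m n≤i*2)
    v : Fin n
    v = fromℕ< i*2<n

  half-proper : ∀ {v w} → CompCycAdj n v w → half v ≢ half w
  half-proper {v} {w} (v≢w , ¬v~w) same
    with ⌊n/2⌋-sameFiber (toℕ v) (toℕ w) (trans (sym (toℕ-half v)) (trans (cong toℕ same) (toℕ-half w)))
  ... | inj₁ v≡w          = v≢w (toℕ-injective v≡w)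
  ... | inj₂ (inj₁ w≡1+v) = ¬v~w (successor⇒cycAdj w≡1+v)
  ... | inj₂ (inj₂ v≡1+w) = ¬v~w (Sum.swap (successor⇒cycAdj v≡1+w))

  bothApart : ∀ {a j} → Apart {n} a (j * 2) → Apart a (suc (j * 2)) → ∀ x → ⌊ x /2⌋ ≡ j → Apart a x
  bothApart {j = j} even odd x half≡j with ⌊n/2⌋-fiber x j half≡j
  ... | inj₁ refl = even
  ... | inj₂ refl = odd

  dominatingHalf : ∀ a → ∃ λ j → j ≤ 2 × (∀ x → ⌊ x /2⌋ ≡ j → Apart {n} a x)
  dominatingHalf 0 = 1 , m≤m+n 1 1 , bothApart (below (m≤m+n 2 0) (inj₁ (≤-trans (m≤m+n 4 2) 6≤n)))
                                               (below (m≤m+n 2 1) (inj₁ (≤-trans (m≤m+n 5 1) 6≤n)))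
  dominatingHalf 1 = 2 , m≤m+n 2 0 , bothApart (below (m≤m+n 3 1) (inj₂ (s≤s z≤n)))
                                               (below (m≤m+n 3 2) (inj₂ (s≤s z≤n)))
  dominatingHalf 2 = 2 , m≤m+n 2 0 , bothApart (below (m≤m+n 4 0) (inj₂ (s≤s z≤n)))
                                               (below (m≤m+n 4 1) (inj₂ (s≤s z≤n)))
  dominatingHalf 3 = 0 , z≤n , bothApart (above (m≤m+n 2 1) (inj₁ (≤-trans (m≤m+n 5 1) 6≤n)))
                                         (above (m≤m+n 3 0) (inj₁ (≤-trans (m≤m+n 5 1) 6≤n)))
  dominatingHalf 4 = 0 , z≤n , bothApart (above (m≤m+n 2 2) (inj₁ (≤-trans (m≤m+n 6 0) 6≤n)))
                                         (above (m≤m+n 3 1) (inj₁ (≤-trans (m≤m+n 6 0) 6≤n)))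
  dominatingHalf (suc (suc (suc (suc (suc b))))) =
    1 , m≤m+n 1 1 , bothApart (above (m≤m+n 4 (suc b)) (inj₂ (s≤s z≤n)))
                              (above (m≤m+n 5 b) (inj₂ (s≤s z≤n)))

  half-dominating : ∀ v → ∃ λ i → ∀ u → half u ≡ i → CompCycAdj n v u
  half-dominating v with dominatingHalf (toℕ v)
  ... | j , j≤2 , apart = fromℕ< j<⌈n/2⌉ , λ u same → apart⇒compCycAdj (apart (toℕ u) (begin
      ⌊ toℕ u /2⌋          ≡⟨ sym (toℕ-half u) ⟩
      toℕ (half u)         ≡⟨ cong toℕ same ⟩
      toℕ (fromℕ< j<⌈n/2⌉) ≡⟨ toℕ-fromℕ< j<⌈n/2⌉ ⟩
      j                    ∎))
    where
    open ≡-Reasoning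
    j<⌈n/2⌉ : j < ⌈ n /2⌉
    j<⌈n/2⌉ = ≤-trans (s≤s j≤2) (⌈n/2⌉-mono 6≤n)

  halfColoring : TotalDominatorColoring (complementCycle n) ⌈ n /2⌉
  halfColoring = record
    { col = half ; surjective = half-surjective ; proper = half-proper ; dominating = half-dominating }

-- n = 4 and n = 5, where facts about concrete vertices are decided by evaluation

infixl 6 _⊕_

_⊕_ : ∀ {n} .{{_ : NonZero n}} → Fin n → ℕ → Fin n
_⊕_ {n} v r = (toℕ v + r) mod n

module ComplementC₄ where

  C̄₄ : Graph 4
  C̄₄ = complementCycle 4

  adj? : Decidable (Adj C̄₄)
  adj? = compCycAdj?

  antipode-unique : ∀ v x → Adj C̄₄ v x → x ≡ v ⊕ 2
  antipode-unique = from-yes (all? λ (v : Fin 4) → all? λ x → adj? v x →-dec x ≟ v ⊕ 2)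

  antipode-involutive : ∀ v → (v ⊕ 2) ⊕ 2 ≡ v
  antipode-involutive = from-yes (all? λ (v : Fin 4) → (v ⊕ 2) ⊕ 2 ≟ v)

  identityColoring : TotalDominatorColoring C̄₄ 4
  identityColoring = toTotalDominatorColoring (from-yes (isTotalDominatorColoring? {G = C̄₄} adj? id))

  -- u is the only neighbor of u ⊕ 2, so the class dominating u ⊕ 2 is {u}.
  colors-injective : ∀ {k} (T : TotalDominatorColoring C̄₄ k) →
                      ∀ {u w} → TotalDominatorColoring.col T u ≡ TotalDominatorColoring.col T w → u ≡ w
  colors-injective T {u} {w} same with dominatingNeighbour T (u ⊕ 2)
  ... | x , u⊕2~x , class⊆N = sym (trans (antipode-unique _ w (class⊆N w w~x)) (antipode-involutive u))
    where
    open TotalDominatorColoring T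
    x≡u : x ≡ u
    x≡u = trans (antipode-unique _ x u⊕2~x) (antipode-involutive u)
    w~x : col w ≡ col x
    w~x = trans (sym same) (cong col (sym x≡u))

  χ : TotalDominatorChromaticNumber C̄₄ 4
  χ = identityColoring , λ k T → injective⇒≤ (colors-injective T)

module ComplementC₅ where

  C̄₅ : Graph 5
  C̄₅ = complementCycle 5

  adj? : Decidable (Adj C̄₅)
  adj? = compCycAdj?

  adjacent : ∀ u w → {True (adj? u w)} → Adj C̄₅ u w
  adjacent u w {u~w} = toWitness u~w

  nonAdjacent : ∀ u w → {False (adj? u w)} → ¬ Adj C̄₅ u w
  nonAdjacent u w {u≁w} = toWitnessFalse u≁w

  neighbors : ∀ v x → Adj C̄₅ v x → x ≡ v ⊕ 2 ⊎ x ≡ v ⊕ 3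
  neighbors = from-yes (all? λ (v : Fin 5) → all? λ x → adj? v x →-dec (x ≟ v ⊕ 2 ⊎-dec x ≟ v ⊕ 3))

  rotation-surjective : ∀ (r v : Fin 5) → ∃ λ u → u ⊕ toℕ r ≡ v
  rotation-surjective = from-yes (all? λ (r : Fin 5) → all? λ v → any? λ (u : Fin 5) → u ⊕ toℕ r ≟ v)

  rotation-preserves : ∀ (r : Fin 5) v w → Adj C̄₅ v w → Adj C̄₅ (v ⊕ toℕ r) (w ⊕ toℕ r)
  rotation-preserves = from-yes (all? λ (r : Fin 5) → all? λ v → all? λ w →
                                   adj? v w →-dec adj? (v ⊕ toℕ r) (w ⊕ toℕ r))

  rotation-reflects : ∀ (r : Fin 5) v w → Adj C̄₅ (v ⊕ toℕ r) (w ⊕ toℕ r) → Adj C̄₅ v w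
  rotation-reflects = from-yes (all? λ (r : Fin 5) → all? λ v → all? λ w →
                                  adj? (v ⊕ toℕ r) (w ⊕ toℕ r) →-dec adj? v w)

  rotation : ∀ (r : Fin 5) → IsAutomorphism C̄₅ (_⊕ toℕ r)
  rotation r = record
    { surjective = rotation-surjective r
    ; preserves  = rotation-preserves r _ _
    ; reflects   = rotation-reflects r _ _
    }

  mergeFirstTwo : Fin 5 → Fin 4
  mergeFirstTwo zero    = zero
  mergeFirstTwo (suc i) = i

  fourColoring : TotalDominatorColoring C̄₅ 4
  fourColoring = toTotalDominatorColoring (from-yes (isTotalDominatorColoring? {G = C̄₅} adj? mergeFirstTwo))

  module _ {k : ℕ} (T : TotalDominatorColoring C̄₅ k) where
    open TotalDominatorColoring T

    -- Vertices 0, 2, 3, 4 then get four different colors: a common color on the C₅-edge 23 or 34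
    -- would leave vertex 4, resp. 2, without a class inside its neighborhood.
    monochromaticEdge⇒4≤ : col (# 0) ≡ col (# 1) → 4 ≤ k
    monochromaticEdge⇒4≤ c₀≡c₁ = distinct⇒≤ {xs = col (# 0) ∷ col (# 2) ∷ col (# 3) ∷ col (# 4) ∷ []}
      ( (proper (adjacent (# 0) (# 2)) ∷ proper (adjacent (# 0) (# 3)) ∷ c₀≢c₄ ∷ [])
      ∷ (c₂≢c₃ ∷ proper (adjacent (# 2) (# 4)) ∷ [])
      ∷ (c₃≢c₄ ∷ [])
      ∷ [] ∷ [])
      where
      c₀≢c₄ : col (# 0) ≢ col (# 4)
      c₀≢c₄ c₀≡c₄ = proper (adjacent (# 1) (# 4)) (trans (sym c₀≡c₁) c₀≡c₄)

      c₂≢c₃ : col (# 2) ≢ col (# 3)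
      c₂≢c₃ c₂≡c₃ = noDominatingClass T (# 4) λ x 4~x → case neighbors (# 4) x 4~x of λ
        { (inj₁ refl) → # 0 , nonAdjacent (# 4) (# 0) , c₀≡c₁
        ; (inj₂ refl) → # 3 , nonAdjacent (# 4) (# 3) , sym c₂≡c₃ }

      c₃≢c₄ : col (# 3) ≢ col (# 4)
      c₃≢c₄ c₃≡c₄ = noDominatingClass T (# 2) λ x 2~x → case neighbors (# 2) x 2~x of λ
        { (inj₁ refl) → # 3 , nonAdjacent (# 2) (# 3) , c₃≡c₄
        ; (inj₂ refl) → # 1 , nonAdjacent (# 2) (# 1) , sym c₀≡c₁ }

  module _ {k : ℕ} (T : TotalDominatorColoring C̄₅ k) where
    open TotalDominatorColoring T

    atLeastFourColors : 4 ≤ k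
    atLeastFourColors with any? (λ r → col (# 0 ⊕ toℕ r) ≟ col (# 1 ⊕ toℕ r))
    ... | yes (r , edge) = monochromaticEdge⇒4≤ (precomposeAutomorphism (rotation r) T) edge
    ... | no noEdge = distinct⇒≤ {xs = col (# 0) ∷ col (# 1) ∷ col (# 2) ∷ col (# 3) ∷ []}
      ( (notMonochromatic (# 0) ∷ proper (adjacent (# 0) (# 2)) ∷ proper (adjacent (# 0) (# 3)) ∷ [])
      ∷ (notMonochromatic (# 1) ∷ proper (adjacent (# 1) (# 3)) ∷ [])
      ∷ (notMonochromatic (# 2) ∷ [])
      ∷ [] ∷ [])
      where
      notMonochromatic : ∀ r → col (# 0 ⊕ toℕ r) ≢ col (# 1 ⊕ toℕ r)
      notMonochromatic r edge = noEdge (r , edge)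

  χ : TotalDominatorChromaticNumber C̄₅ 4
  χ = fourColoring , λ k T → atLeastFourColors T

proposition4p4 : (n : ℕ) (4≤n : 4 ≤ n) .{{_ : NonZero n}}
    → (n ≡ 4 → TotalDominatorChromaticNumber (complementCycle n) 4)
      × (n ≡ 5 → TotalDominatorChromaticNumber (complementCycle n) 4)
      × (6 ≤ n → TotalDominatorChromaticNumber (complementCycle n) (ceilHalf n))
proposition4p4 n 4≤n = (λ { refl → ComplementC₄.χ }) , (λ { refl → ComplementC₅.χ }) , χ≥6
  where
  χ≥6 : 6 ≤ n → TotalDominatorChromaticNumber (complementCycle n) (ceilHalf n)
  χ≥6 6≤n = subst (TotalDominatorChromaticNumber (complementCycle n)) (sym (ceilHalf≡⌈n/2⌉ n))
    (HalfColoring.halfColoring 6≤n , λ k T → ⌈n/2⌉≤colors T 4≤n)
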